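{- If $A$ and $B$ are input types of System $\mathcal F$, then $A\wedge B$, $A\vee B$ and $LA$ are input types.
   Context: System $\mathcal F$: types are built from type variables (and type constants) with $\rightarrow$ and $\forall$ (only types where quantified variables occur in their scope); typing $\Gamma\vdash_{\mathcal F}t:A$ of pure $\lambda$-terms by (ax), ($\rightarrow_i$), ($\rightarrow_e$), ($\forall_i$): from $\Gamma\vdash t:A$, $X$ not free in $\Gamma$, infer $\Gamma\vdash t:\forall XA$, and ($\forall_e$): from $\Gamma\vdash t:\forall XA$ infer $\Gamma\vdash t:A[C/X]$. $\mathcal F_0$ is $\mathcal F$ without ($\forall_e$). A closed type $E$ is an input type iff every $\beta$-normal $t$ with $\vdash_{\mathcal F}t:E$ satisfies $\vdash_{\mathcal F_0}t:E$. Here $A\wedge B=\forall X\{(A\rightarrow(B\rightarrow X))\rightarrow X\}$, $A\vee B=\forall X\{(A\rightarrow X)\rightarrow((B\rightarrow X)\rightarrow X)\}$, and $LA=\forall X\{X\rightarrow[(A\rightarrow(X\rightarrow X))\rightarrow X]\}$, with $X$ not free in $A,B$. -}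

module Defs where

open import Data.Nat using (ℕ; zero; suc)
open import Data.Fin using (Fin)
open import Data.Vec using (Vec; []; _∷_; lookup; map)
open import Data.Product using (_×_)
open import Relation.Nullary using (¬_)

infixr 7 _⇒_

data Ty : Set where
  var   : ℕ → Ty
  const : ℕ → Ty
  _⇒_   : Ty → Ty → Ty
  ∀'    : Ty → Ty          -- ∀' A binds index 0 in A

ext : (ℕ → ℕ) → ℕ → ℕ
ext ρ zero    = zero
ext ρ (suc n) = suc (ρ n)

rename : (ℕ → ℕ) → Ty → Ty
rename ρ (var n)   = var (ρ n)
rename ρ (const c) = const c
rename ρ (A ⇒ B)   = rename ρ A ⇒ rename ρ B
rename ρ (∀' A)    = ∀' (rename (ext ρ) A)

shift : Ty → Ty
shift = rename suc

exts : (ℕ → Ty) → ℕ → Ty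
exts σ zero    = var zero
exts σ (suc n) = shift (σ n)

subst : (ℕ → Ty) → Ty → Ty
subst σ (var n)   = σ n
subst σ (const c) = const c
subst σ (A ⇒ B)   = subst σ A ⇒ subst σ B
subst σ (∀' A)    = ∀' (subst (exts σ) A)

-- A [ C ]  is  A[C/X] where X is the variable bound by the outer ∀
sub0 : Ty → ℕ → Ty
sub0 C zero    = C
sub0 C (suc n) = var n

_[_] : Ty → Ty → Ty
A [ C ] = subst (sub0 C) A

data Occurs : ℕ → Ty → Set where
  here : ∀ {n} → Occurs n (var n)
  ⇒ˡ   : ∀ {n A B} → Occurs n A → Occurs n (A ⇒ B)
  ⇒ʳ   : ∀ {n A B} → Occurs n B → Occurs n (A ⇒ B)
  under : ∀ {n A} → Occurs (suc n) A → Occurs n (∀' A)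

data WF : Ty → Set where
  wf-var   : ∀ {n} → WF (var n)
  wf-const : ∀ {c} → WF (const c)
  wf-⇒     : ∀ {A B} → WF A → WF B → WF (A ⇒ B)
  wf-∀     : ∀ {A} → Occurs zero A → WF A → WF (∀' A)

Closed : Ty → Set
Closed E = ∀ n → ¬ Occurs n E

data Tm (n : ℕ) : Set where
  var : Fin n → Tm n
  lam : Tm (suc n) → Tm n
  app : Tm n → Tm n → Tm n

data Ne {n : ℕ} : Tm n → Set
data Nf {n : ℕ} : Tm n → Set

data Ne {n} where
  ne-var : ∀ x → Ne (var x)
  ne-app : ∀ {t u} → Ne t → Nf u → Ne (app t u)

data Nf {n} where
  nf-ne  : ∀ {t} → Ne t → Nf t
  nf-lam : ∀ {t} → Nf t → Nf (lam t)

-- Typing: system F and F₀ (= F without ∀-elimination)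

data System : Set where
  F F₀ : System

Ctx : ℕ → Set
Ctx n = Vec Ty n

infix 4 _⊢[_]_∶_

-- "X not free in Γ" is rendered in de Bruijn style: the premise is typed
-- in the context with all free type variables shifted.
data _⊢[_]_∶_ {n : ℕ} (Γ : Ctx n) : System → Tm n → Ty → Set where
  ax  : ∀ {S} x → Γ ⊢[ S ] var x ∶ lookup Γ x
  ⇒i  : ∀ {S t A B} → WF A → (A ∷ Γ) ⊢[ S ] t ∶ B → Γ ⊢[ S ] lam t ∶ A ⇒ B
  ⇒e  : ∀ {S t u A B} → Γ ⊢[ S ] t ∶ A ⇒ B → Γ ⊢[ S ] u ∶ A → Γ ⊢[ S ] app t u ∶ B
  ∀i  : ∀ {S t A} → WF (∀' A) → map shift Γ ⊢[ S ] t ∶ A → Γ ⊢[ S ] t ∶ ∀' A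
  ∀e  : ∀ {t A C} → WF C → Γ ⊢[ F ] t ∶ ∀' A → Γ ⊢[ F ] t ∶ A [ C ]

InputType : Ty → Set
InputType E = WF E × Closed E ×
  (∀ (t : Tm 0) → Nf t → [] ⊢[ F ] t ∶ E → [] ⊢[ F₀ ] t ∶ E)

-- Connectives (X = index 0, A and B shifted under the binder)

_∧_ : Ty → Ty → Ty
A ∧ B = ∀' ((shift A ⇒ (shift B ⇒ var 0)) ⇒ var 0)

_∨_ : Ty → Ty → Ty
A ∨ B = ∀' ((shift A ⇒ var 0) ⇒ ((shift B ⇒ var 0) ⇒ var 0))

L : Ty → Ty
L A = ∀' (var 0 ⇒ ((shift A ⇒ (var 0 ⇒ var 0)) ⇒ var 0))

module Submission where

-- All three types have the shape ∀X (H₁ ⇒ … ⇒ Hₖ ⇒ X) where each hypothesis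
-- Hᵢ is c₁ ⇒ … ⇒ cⱼ ⇒ X and each argument type c is X or an input type; we
-- prove once that every such type is an input type (`spine-input-type`).
-- A closed normal term of it is λh₁…hₖ.u, where (spine lemma) u is a
-- hypothesis applied to arguments of the evident types.  Arguments of type X
-- are handled recursively.  For an argument p of input type E we replace
-- each hypothesis applied to j arguments by λ…λ.ω (ω = λx.xx) and set
-- X := (∀Y.Y⇒Y) ⇒ (∀Y.Y⇒Y); the result is a closed normal term of type E,
-- F₀-typable by assumption.  As F₀ cannot type a self-application, nothing
-- was replaced, so p is that closed F₀-typable term.

open import Defs
open import Data.Nat using (ℕ; zero; suc; _+_; _∸_; _≤_; s≤s)
open import Data.Nat.Properties using (≤-refl; ≤-trans; ≤-reflexive; n≤1+n; m≤m+n; <-irrefl; ≤-<-trans; +-suc; m+n∸m≡n)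
open import Data.Fin using (Fin; zero; suc; splitAt; _↑ˡ_; _↑ʳ_)
open import Data.Fin.Properties using (splitAt⁻¹-↑ˡ; splitAt⁻¹-↑ʳ)
open import Data.Vec using ([]; _∷_; lookup; map; _++_)
open import Data.Vec.Properties using (lookup-map; lookup-++ˡ; lookup-++ʳ; map-++)
open import Data.List as List using (List; []; _∷_; length)
open import Data.List.Properties using (length-map)
open import Data.List.Relation.Unary.All as All using (All; []; _∷_)
open import Data.List.Relation.Unary.All.Properties using (map⁺)
open import Data.Maybe as Maybe using (Maybe; just; nothing)
open import Data.Product using (Σ; _×_; _,_; proj₁)
open import Data.Sum using (_⊎_; inj₁; inj₂)
open import Data.Empty using (⊥; ⊥-elim)
open import Relation.Nullary using (¬_)
open import Relation.Binary.PropositionalEquality as Eq using (_≡_; refl; sym; trans; cong; cong₂)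

ext-cong : ∀ {ρ ρ' : ℕ → ℕ} → (∀ n → ρ n ≡ ρ' n) → ∀ n → ext ρ n ≡ ext ρ' n
ext-cong e zero    = refl
ext-cong e (suc n) = cong suc (e n)

rename-cong : ∀ {ρ ρ'} → (∀ n → ρ n ≡ ρ' n) → ∀ A → rename ρ A ≡ rename ρ' A
rename-cong e (var n)   = cong var (e n)
rename-cong e (const c) = refl
rename-cong e (A ⇒ B)   = cong₂ _⇒_ (rename-cong e A) (rename-cong e B)
rename-cong e (∀' A)    = cong ∀' (rename-cong (ext-cong e) A)

exts-cong : ∀ {σ τ : ℕ → Ty} → (∀ n → σ n ≡ τ n) → ∀ n → exts σ n ≡ exts τ n
exts-cong e zero    = refl
exts-cong e (suc n) = cong shift (e n)

subst-cong : ∀ {σ τ} → (∀ n → σ n ≡ τ n) → ∀ A → subst σ A ≡ subst τ A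
subst-cong e (var n)   = e n
subst-cong e (const c) = refl
subst-cong e (A ⇒ B)   = cong₂ _⇒_ (subst-cong e A) (subst-cong e B)
subst-cong e (∀' A)    = cong ∀' (subst-cong (exts-cong e) A)

rename-rename : ∀ ρ ρ' A → rename ρ (rename ρ' A) ≡ rename (λ n → ρ (ρ' n)) A
rename-rename ρ ρ' (var n)   = refl
rename-rename ρ ρ' (const c) = refl
rename-rename ρ ρ' (A ⇒ B)   = cong₂ _⇒_ (rename-rename ρ ρ' A) (rename-rename ρ ρ' B)
rename-rename ρ ρ' (∀' A)    =
  cong ∀' (trans (rename-rename (ext ρ) (ext ρ') A) (rename-cong ext-comp A))
  where
  ext-comp : ∀ n → ext ρ (ext ρ' n) ≡ ext (λ n → ρ (ρ' n)) n
  ext-comp zero    = refl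
  ext-comp (suc n) = refl

subst-rename : ∀ σ ρ A → subst σ (rename ρ A) ≡ subst (λ n → σ (ρ n)) A
subst-rename σ ρ (var n)   = refl
subst-rename σ ρ (const c) = refl
subst-rename σ ρ (A ⇒ B)   = cong₂ _⇒_ (subst-rename σ ρ A) (subst-rename σ ρ B)
subst-rename σ ρ (∀' A)    =
  cong ∀' (trans (subst-rename (exts σ) (ext ρ) A) (subst-cong exts-ext A))
  where
  exts-ext : ∀ n → exts σ (ext ρ n) ≡ exts (λ n → σ (ρ n)) n
  exts-ext zero    = refl
  exts-ext (suc n) = refl

rename-subst : ∀ ρ σ A → rename ρ (subst σ A) ≡ subst (λ n → rename ρ (σ n)) A
rename-subst ρ σ (var n)   = refl
rename-subst ρ σ (const c) = refl
rename-subst ρ σ (A ⇒ B)   = cong₂ _⇒_ (rename-subst ρ σ A) (rename-subst ρ σ B)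
rename-subst ρ σ (∀' A)    =
  cong ∀' (trans (rename-subst (ext ρ) (exts σ) A) (subst-cong ext-exts A))
  where
  ext-exts : ∀ n → rename (ext ρ) (exts σ n) ≡ exts (λ n → rename ρ (σ n)) n
  ext-exts zero    = refl
  ext-exts (suc n) = trans (rename-rename (ext ρ) suc (σ n)) (sym (rename-rename suc ρ (σ n)))

subst-subst : ∀ σ τ A → subst σ (subst τ A) ≡ subst (λ n → subst σ (τ n)) A
subst-subst σ τ (var n)   = refl
subst-subst σ τ (const c) = refl
subst-subst σ τ (A ⇒ B)   = cong₂ _⇒_ (subst-subst σ τ A) (subst-subst σ τ B)
subst-subst σ τ (∀' A)    =
  cong ∀' (trans (subst-subst (exts σ) (exts τ) A) (subst-cong exts-exts A))
  where
  exts-exts : ∀ n → subst (exts σ) (exts τ n) ≡ exts (λ n → subst σ (τ n)) n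
  exts-exts zero    = refl
  exts-exts (suc n) = trans (subst-rename (exts σ) suc (τ n)) (sym (rename-subst suc σ (τ n)))

subst-var : ∀ A → subst var A ≡ A
subst-var (var n)   = refl
subst-var (const c) = refl
subst-var (A ⇒ B)   = cong₂ _⇒_ (subst-var A) (subst-var B)
subst-var (∀' A)    = cong ∀' (trans (subst-cong exts-var A) (subst-var A))
  where
  exts-var : ∀ n → exts var n ≡ var n
  exts-var zero    = refl
  exts-var (suc n) = refl

subst-shift : ∀ σ A → subst (exts σ) (shift A) ≡ shift (subst σ A)
subst-shift σ A = trans (subst-rename (exts σ) suc A) (sym (rename-subst suc σ A))

sub0-shift : ∀ C A → subst (sub0 C) (shift A) ≡ A
sub0-shift C A = trans (subst-rename (sub0 C) suc A) (subst-var A)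

subst-inst : ∀ σ A C → subst σ (A [ C ]) ≡ (subst (exts σ) A) [ subst σ C ]
subst-inst σ A C = begin
  subst σ (subst (sub0 C) A)                        ≡⟨ subst-subst σ (sub0 C) A ⟩
  subst (λ n → subst σ (sub0 C n)) A                ≡⟨ subst-cong pointwise A ⟩
  subst (λ n → subst (sub0 (subst σ C)) (exts σ n)) A ≡⟨ sym (subst-subst (sub0 (subst σ C)) (exts σ) A) ⟩
  subst (sub0 (subst σ C)) (subst (exts σ) A)       ∎
  where
  open Eq.≡-Reasoning
  pointwise : ∀ n → subst σ (sub0 C n) ≡ subst (sub0 (subst σ C)) (exts σ n)
  pointwise zero    = refl
  pointwise (suc n) = sym (sub0-shift (subst σ C) (σ n))

occurs-rename : ∀ {n A} ρ → Occurs n A → Occurs (ρ n) (rename ρ A)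
occurs-rename ρ here      = here
occurs-rename ρ (⇒ˡ o)    = ⇒ˡ (occurs-rename ρ o)
occurs-rename ρ (⇒ʳ o)    = ⇒ʳ (occurs-rename ρ o)
occurs-rename ρ (under o) = under (occurs-rename (ext ρ) o)

occurs-rename⁻ : ∀ {n} ρ A → Occurs n (rename ρ A) → Σ ℕ λ m → ρ m ≡ n × Occurs m A
occurs-rename⁻ ρ (var x) here = x , refl , here
occurs-rename⁻ ρ (A ⇒ B) (⇒ˡ o) with occurs-rename⁻ ρ A o
... | m , e , o' = m , e , ⇒ˡ o'
occurs-rename⁻ ρ (A ⇒ B) (⇒ʳ o) with occurs-rename⁻ ρ B o
... | m , e , o' = m , e , ⇒ʳ o'
occurs-rename⁻ ρ (∀' A) (under o) with occurs-rename⁻ (ext ρ) A o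
... | zero  , ()   , o'
... | suc m , refl , o' = m , refl , under o'

shift-fresh : ∀ A → ¬ Occurs 0 (shift A)
shift-fresh A o with occurs-rename⁻ suc A o
... | m , () , _

shift-closed : ∀ {A} → Closed A → ∀ n → ¬ Occurs (suc n) (shift A)
shift-closed {A} c n o with occurs-rename⁻ suc A o
... | m , refl , o' = c m o'

occurs-subst : ∀ {n m A} σ → Occurs n A → Occurs m (σ n) → Occurs m (subst σ A)
occurs-subst σ here      o' = o'
occurs-subst σ (⇒ˡ o)    o' = ⇒ˡ (occurs-subst σ o o')
occurs-subst σ (⇒ʳ o)    o' = ⇒ʳ (occurs-subst σ o o')
occurs-subst σ (under o) o' = under (occurs-subst (exts σ) o (occurs-rename suc o'))

WF-rename : ∀ ρ {A} → WF A → WF (rename ρ A)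
WF-rename ρ wf-var     = wf-var
WF-rename ρ wf-const   = wf-const
WF-rename ρ (wf-⇒ a b) = wf-⇒ (WF-rename ρ a) (WF-rename ρ b)
WF-rename ρ (wf-∀ o a) = wf-∀ (occurs-rename (ext ρ) o) (WF-rename (ext ρ) a)

WFσ : (ℕ → Ty) → Set
WFσ σ = ∀ n → WF (σ n)

WF-exts : ∀ {σ} → WFσ σ → WFσ (exts σ)
WF-exts w zero    = wf-var
WF-exts w (suc n) = WF-rename suc (w n)

WF-subst : ∀ {σ A} → WFσ σ → WF A → WF (subst σ A)
WF-subst w wf-var         = w _
WF-subst w wf-const       = wf-const
WF-subst w (wf-⇒ a b)     = wf-⇒ (WF-subst w a) (WF-subst w b)
WF-subst {σ} w (wf-∀ o a) = wf-∀ (occurs-subst (exts σ) o here) (WF-subst (WF-exts w) a)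

WF-sub0 : ∀ {C} → WF C → WFσ (sub0 C)
WF-sub0 c zero    = c
WF-sub0 c (suc n) = wf-var

rename-fixed : ∀ ρ A → (∀ n → Occurs n A → ρ n ≡ n) → rename ρ A ≡ A
rename-fixed ρ (var n)   h = cong var (h n here)
rename-fixed ρ (const c) h = refl
rename-fixed ρ (A ⇒ B)   h =
  cong₂ _⇒_ (rename-fixed ρ A (λ n o → h n (⇒ˡ o))) (rename-fixed ρ B (λ n o → h n (⇒ʳ o)))
rename-fixed ρ (∀' A)    h = cong ∀' (rename-fixed (ext ρ) A h')
  where
  h' : ∀ n → Occurs n A → ext ρ n ≡ n
  h' zero    o = refl
  h' (suc n) o = cong suc (h n (under o))

closed-shift : ∀ {A} → Closed A → shift A ≡ A
closed-shift {A} c = rename-fixed suc A (λ n o → ⊥-elim (c n o))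

infixr 6 _⇛_
_⇛_ : List Ty → Ty → Ty
[]       ⇛ B = B
(c ∷ cs) ⇛ B = c ⇒ (cs ⇛ B)

shift-⇛ : ∀ cs B → shift (cs ⇛ B) ≡ List.map shift cs ⇛ shift B
shift-⇛ []       B = refl
shift-⇛ (c ∷ cs) B = cong (shift c ⇒_) (shift-⇛ cs B)

subst-⇛ : ∀ σ cs B → subst σ (cs ⇛ B) ≡ List.map (subst σ) cs ⇛ subst σ B
subst-⇛ σ []       B = refl
subst-⇛ σ (c ∷ cs) B = cong (subst σ c ⇒_) (subst-⇛ σ cs B)

WF-⇛ : ∀ {cs B} → All WF cs → WF B → WF (cs ⇛ B)
WF-⇛ []       b = b
WF-⇛ (a ∷ as) b = wf-⇒ a (WF-⇛ as b)

occurs-target : ∀ {m} cs {B} → Occurs m B → Occurs m (cs ⇛ B)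
occurs-target []       o = o
occurs-target (c ∷ cs) o = ⇒ʳ (occurs-target cs o)

not-occurs-⇛ : ∀ {m cs B} → All (λ c → ¬ Occurs m c) cs → ¬ Occurs m B → ¬ Occurs m (cs ⇛ B)
not-occurs-⇛ []       nb o      = nb o
not-occurs-⇛ (nc ∷ _) nb (⇒ˡ o) = nc o
not-occurs-⇛ (_ ∷ ns) nb (⇒ʳ o) = not-occurs-⇛ ns nb o

ctx-shift-subst : ∀ {n} σ (Γ : Ctx n) → map shift (map (subst σ) Γ) ≡ map (subst (exts σ)) (map shift Γ)
ctx-shift-subst σ []      = refl
ctx-shift-subst σ (A ∷ Γ) = cong₂ _∷_ (sym (subst-shift σ A)) (ctx-shift-subst σ Γ)

ctx-sub0-shift : ∀ {n} C (Γ : Ctx n) → map (subst (sub0 C)) (map shift Γ) ≡ Γ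
ctx-sub0-shift C []      = refl
ctx-sub0-shift C (A ∷ Γ) = cong₂ _∷_ (sub0-shift C A) (ctx-sub0-shift C Γ)

typing-subst : ∀ {n S} {Γ : Ctx n} {t T} σ → WFσ σ → Γ ⊢[ S ] t ∶ T → map (subst σ) Γ ⊢[ S ] t ∶ subst σ T
typing-subst {Γ = Γ} σ w (ax x) =
  Eq.subst (λ T → map (subst σ) Γ ⊢[ _ ] var x ∶ T) (lookup-map x (subst σ) Γ) (ax x)
typing-subst σ w (⇒i a d) = ⇒i (WF-subst w a) (typing-subst σ w d)
typing-subst σ w (⇒e d e) = ⇒e (typing-subst σ w d) (typing-subst σ w e)
typing-subst {Γ = Γ} {t} σ w (∀i {A = A} a d) =
  ∀i (WF-subst w a) (Eq.subst (λ G → G ⊢[ _ ] t ∶ subst (exts σ) A) (sym (ctx-shift-subst σ Γ))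
                       (typing-subst (exts σ) (WF-exts w) d))
typing-subst {Γ = Γ} {t} σ w (∀e {A = A} {C} c d) =
  Eq.subst (λ T → map (subst σ) Γ ⊢[ F ] t ∶ T) (sym (subst-inst σ A C)) (∀e (WF-subst w c) (typing-subst σ w d))

extF : ∀ {n m} → (Fin n → Fin m) → Fin (suc n) → Fin (suc m)
extF ρ zero    = zero
extF ρ (suc i) = suc (ρ i)

renTm : ∀ {n m} → (Fin n → Fin m) → Tm n → Tm m
renTm ρ (var x)   = var (ρ x)
renTm ρ (lam t)   = lam (renTm (extF ρ) t)
renTm ρ (app s t) = app (renTm ρ s) (renTm ρ t)

renTm-cong : ∀ {n m} {f g : Fin n → Fin m} → (∀ i → f i ≡ g i) → ∀ t → renTm f t ≡ renTm g t
renTm-cong e (var x) = cong var (e x)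
renTm-cong {f = f} {g} e (lam t) = cong lam (renTm-cong e' t)
  where
  e' : ∀ i → extF f i ≡ extF g i
  e' zero    = refl
  e' (suc i) = cong suc (e i)
renTm-cong e (app s t) = cong₂ app (renTm-cong e s) (renTm-cong e t)

typing-rename : ∀ {n m S} {Γ : Ctx n} {Δ : Ctx m} {t T} (ρ : Fin n → Fin m) →
  (∀ x → lookup Δ (ρ x) ≡ lookup Γ x) → Γ ⊢[ S ] t ∶ T → Δ ⊢[ S ] renTm ρ t ∶ T
typing-rename {Δ = Δ} ρ h (ax x) = Eq.subst (λ T → Δ ⊢[ _ ] var (ρ x) ∶ T) (h x) (ax (ρ x))
typing-rename {Γ = Γ} {Δ} ρ h (⇒i {A = A} a d) = ⇒i a (typing-rename (extF ρ) h' d)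
  where
  h' : ∀ x → lookup (A ∷ Δ) (extF ρ x) ≡ lookup (A ∷ Γ) x
  h' zero    = refl
  h' (suc x) = h x
typing-rename ρ h (⇒e d e) = ⇒e (typing-rename ρ h d) (typing-rename ρ h e)
typing-rename {Γ = Γ} {Δ} ρ h (∀i a d) = ∀i a (typing-rename ρ h' d)
  where
  h' : ∀ x → lookup (map shift Δ) (ρ x) ≡ lookup (map shift Γ) x
  h' x = trans (lookup-map (ρ x) shift Δ) (trans (cong shift (h x)) (sym (lookup-map x shift Γ)))
typing-rename ρ h (∀e c d) = ∀e c (typing-rename ρ h d)

-- Generation lemma for λ in F: a typing of λu is a typing of u at an arrow
-- type, followed by ∀-introductions (∀-eliminations are absorbed by
-- substitution).

data LamTyping {n} (Γ : Ctx n) (u : Tm (suc n)) : Ty → Set where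
  arr : ∀ {P Q} → (P ∷ Γ) ⊢[ F ] u ∶ Q → LamTyping Γ u (P ⇒ Q)
  gen : ∀ {T} → WF (∀' T) → LamTyping (map shift Γ) u T → LamTyping Γ u (∀' T)

lamTyping-subst : ∀ {n} {Γ : Ctx n} {u T} σ → WFσ σ → LamTyping Γ u T → LamTyping (map (subst σ) Γ) u (subst σ T)
lamTyping-subst σ w (arr d) = arr (typing-subst σ w d)
lamTyping-subst {Γ = Γ} {u} σ w (gen {T} a l) =
  gen (WF-subst w a) (Eq.subst (λ G → LamTyping G u (subst (exts σ) T)) (sym (ctx-shift-subst σ Γ))
                        (lamTyping-subst (exts σ) (WF-exts w) l))

lam-generation : ∀ {n} {Γ : Ctx n} {u T} → Γ ⊢[ F ] lam u ∶ T → LamTyping Γ u T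
lam-generation (⇒i a d) = arr d
lam-generation (∀i a d) = gen a (lam-generation d)
lam-generation {Γ = Γ} {u} (∀e {A = A} {C} c d) with lam-generation d
... | gen a l = Eq.subst (λ G → LamTyping G u (A [ C ])) (ctx-sub0-shift C Γ)
                  (lamTyping-subst (sub0 C) (WF-sub0 c) l)

-- F₀ cannot type a self-application x x: without ∀-elimination the type of
-- a variable only grows, while x x needs x : P ⇒ Q and x : P.

size : Ty → ℕ
size (var n)   = 1
size (const c) = 1
size (A ⇒ B)   = suc (size A + size B)
size (∀' A)    = suc (size A)

size-rename : ∀ ρ A → size (rename ρ A) ≡ size A
size-rename ρ (var n)   = refl
size-rename ρ (const c) = refl
size-rename ρ (A ⇒ B)   = cong₂ (λ a b → suc (a + b)) (size-rename ρ A) (size-rename ρ B)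
size-rename ρ (∀' A)    = cong suc (size-rename (ext ρ) A)

F₀-variable-size : ∀ {n} {Γ : Ctx n} {x T} → Γ ⊢[ F₀ ] var x ∶ T → size (lookup Γ x) ≤ size T
F₀-variable-size (ax x) = ≤-refl
F₀-variable-size {Γ = Γ} {x} (∀i {A = A} a d) =
  ≤-trans (≤-reflexive (sym (trans (cong size (lookup-map x shift Γ)) (size-rename suc _))))
          (≤-trans (F₀-variable-size d) (n≤1+n _))

F₀-variable-inversion : ∀ {n} {Γ : Ctx n} {x T} → Γ ⊢[ F₀ ] var x ∶ T → lookup Γ x ≡ T ⊎ Σ Ty (λ T' → T ≡ ∀' T')
F₀-variable-inversion (ax x)   = inj₁ refl
F₀-variable-inversion (∀i a d) = inj₂ (_ , refl)

F₀-no-self-application : ∀ {n} {Γ : Ctx (suc n)} {T} → ¬ (Γ ⊢[ F₀ ] app (var zero) (var zero) ∶ T)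
F₀-no-self-application (⇒e d₁ d₂) with F₀-variable-inversion d₁
... | inj₁ e       = <-irrefl refl (≤-<-trans (≤-trans (≤-reflexive (cong size (sym e))) (F₀-variable-size d₂))
                                              (s≤s (m≤m+n _ _)))
... | inj₂ (_ , ())
F₀-no-self-application (∀i a d) = F₀-no-self-application d

ω : ∀ {m} → Tm m
ω = lam (app (var zero) (var zero))

data ContainsΩ {m} : Tm m → Set where
  here  : ContainsΩ ω
  inlam : ∀ {b} → ContainsΩ b → ContainsΩ (lam b)
  inl   : ∀ {s t} → ContainsΩ s → ContainsΩ (app s t)
  inr   : ∀ {s t} → ContainsΩ t → ContainsΩ (app s t)

F₀-no-ω : ∀ {n} {Γ : Ctx n} {t T} → Γ ⊢[ F₀ ] t ∶ T → ¬ ContainsΩ t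
F₀-no-ω (⇒i a d) here      = F₀-no-self-application d
F₀-no-ω (⇒i a d) (inlam c) = F₀-no-ω d c
F₀-no-ω (⇒e d e) (inl c)   = F₀-no-ω d c
F₀-no-ω (⇒e d e) (inr c)   = F₀-no-ω e c
F₀-no-ω (∀i a d) c         = F₀-no-ω d c

I : Ty
I = ∀' (var 0 ⇒ var 0)

D : Ty
D = I ⇒ I

WF-I : WF I
WF-I = wf-∀ (⇒ˡ here) (wf-⇒ wf-var wf-var)

WF-D : WF D
WF-D = wf-⇒ WF-I WF-I

ω-typing : ∀ {m} {Γ : Ctx m} → Γ ⊢[ F ] ω ∶ D
ω-typing = ⇒i WF-I (⇒e (∀e WF-I (ax zero)) (ax zero))

lams-ω : ∀ {m} → ℕ → Tm m
lams-ω zero    = ω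
lams-ω (suc j) = lam (lams-ω j)

lams-ω-typing : ∀ {m} {Γ : Ctx m} cs → All WF cs → Γ ⊢[ F ] lams-ω (length cs) ∶ cs ⇛ D
lams-ω-typing []       _        = ω-typing
lams-ω-typing (c ∷ cs) (a ∷ as) = ⇒i a (lams-ω-typing cs as)

lams-ω-normal : ∀ {m} j → Nf (lams-ω {m} j)
lams-ω-normal zero    = nf-lam (nf-ne (ne-app (ne-var zero) (nf-ne (ne-var zero))))
lams-ω-normal (suc j) = nf-lam (lams-ω-normal j)

lams-ω-contains : ∀ {m} j → ContainsΩ (lams-ω {m} j)
lams-ω-contains zero    = here
lams-ω-contains (suc j) = inlam (lams-ω-contains j)

-- Neutral terms are applications  x p₁ … pⱼ  of a variable (the arguments
-- listed innermost first); in particular there are no closed ones.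

apps : ∀ {n} → Tm n → List (Tm n) → Tm n
apps h []       = h
apps h (p ∷ ps) = app (apps h ps) p

neutral-spine : ∀ {n} {t : Tm n} → Ne t → Σ (Fin n) λ x → Σ (List (Tm n)) λ ps → t ≡ apps (var x) ps
neutral-spine (ne-var x) = x , [] , refl
neutral-spine (ne-app {u = u} ne _) with neutral-spine ne
... | x , ps , refl = x , u ∷ ps , refl

closed-not-neutral : ∀ {t : Tm 0} → ¬ Ne t
closed-not-neutral (ne-var ())
closed-not-neutral (ne-app ne _) = closed-not-neutral ne

data Args {n} (Γ : Ctx n) (cs : List Ty) : List (Tm n) → List Ty → Set where
  nil  : Args Γ cs [] cs
  snoc : ∀ {ps p c rest} → Args Γ cs ps (c ∷ rest) → Γ ⊢[ F ] p ∶ c → Args Γ cs (p ∷ ps) rest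

args-suffix : ∀ {n} {Γ : Ctx n} {cs ps rest} {P : Ty → Set} → Args Γ cs ps rest → All P cs → All P rest
args-suffix nil          a = a
args-suffix (snoc ar _) a with args-suffix ar a
... | _ ∷ r = r

args-length : ∀ {n} {Γ : Ctx n} {cs ps rest} → Args Γ cs ps rest → length cs ≡ length ps + length rest
args-length nil = refl
args-length {ps = p ∷ ps} {rest} (snoc ar _) = trans (args-length ar) (+-suc (length ps) (length rest))

shifted-fresh : ∀ cs → All (λ c → ¬ Occurs 0 c) (List.map shift cs)
shifted-fresh []       = []
shifted-fresh (c ∷ cs) = shift-fresh c ∷ shifted-fresh cs

-- ∀-introduction is impossible because the abstracted type would not
-- mention the bound variable, and ∀-elimination because the type is not a ∀.
spine : ∀ {n} {Γ : Ctx n} {t T x ps cs k} → Γ ⊢[ F ] t ∶ T → t ≡ apps (var x) ps →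
  lookup Γ x ≡ cs ⇛ var k → Σ (List Ty) λ rest → Args Γ cs ps rest × T ≡ rest ⇛ var k
spine {ps = []}    (ax x) refl le = _ , nil , le
spine {ps = _ ∷ _} (ax x) ()
spine {ps = []}    (⇒i a d) ()
spine {ps = _ ∷ _} (⇒i a d) ()
spine {ps = []}    (⇒e d e) ()
spine {ps = p ∷ ps} (⇒e d e) refl le with spine d refl le
... | []       , ar , ()
... | c ∷ rest , ar , refl = rest , snoc ar e , refl
spine {Γ = Γ} {x = x} {cs = cs} {k} (∀i (wf-∀ o _) d) eq le
  with spine d eq (trans (lookup-map x shift Γ) (trans (cong shift le) (shift-⇛ cs (var k))))
... | rest , ar , refl = ⊥-elim (not-occurs-⇛ (args-suffix ar (shifted-fresh cs)) (λ ()) o)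
spine (∀e c d) eq le with spine d eq le
... | []    , _ , ()
... | _ ∷ _ , _ , ()

-- Terms live in a context of m ordinary variables followed by
-- n "hypothesis" variables; hypothesis d is meant to be applied to ar d
-- arguments.  `replace` deletes the hypotheses: a hypothesis applied to j
-- arguments becomes λ…λ.ω with ar d ∸ j binders.

module Replacement {n : ℕ} (ar : Fin n → ℕ) where

  hypHead : ∀ {m} → Tm (m + n) → Maybe (Fin n × ℕ)
  hypHead {m} (var x) with splitAt m x
  ... | inj₁ _ = nothing
  ... | inj₂ d = just (d , 0)
  hypHead (lam _)   = nothing
  hypHead (app s t) = Maybe.map (λ (d , j) → d , suc j) (hypHead s)

  hypHead-spine : ∀ {m} (t : Tm (m + n)) {d j} → hypHead t ≡ just (d , j) →
    Σ (List (Tm (m + n))) λ ps → t ≡ apps (var (m ↑ʳ d)) ps × length ps ≡ j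
  hypHead-spine {m} (var x) e with splitAt m x in es
  hypHead-spine {m} (var x) refl | inj₂ d = [] , cong var (sym (splitAt⁻¹-↑ʳ es)) , refl
  hypHead-spine (app s t) e with hypHead s in es
  hypHead-spine (app s t) refl | just (d , j) with hypHead-spine s es
  ... | ps , refl , refl = t ∷ ps , refl , refl

  -- (The second clause is never reached: a hypothesis variable is a `hypHead`.)
  replaceVar : ∀ {m} → Fin m ⊎ Fin n → Tm m
  replaceVar (inj₁ l) = var l
  replaceVar (inj₂ d) = lams-ω (ar d)

  replace : ∀ {m} → Tm (m + n) → Tm m
  replace-at : ∀ {m} → Tm (m + n) → Maybe (Fin n × ℕ) → Tm m
  replace t = replace-at t (hypHead t)
  replace-at t (just (d , j)) = lams-ω (ar d ∸ j)
  replace-at {m} (var x) nothing = replaceVar (splitAt m x)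
  replace-at (lam b)     nothing = lam (replace b)
  replace-at (app s t)   nothing = app (replace s) (replace t)

  replace-normal : ∀ {m} {t : Tm (m + n)} → Nf t → Nf (replace t)
  replace-at-normal : ∀ {m} {t : Tm (m + n)} {h} → Nf t → hypHead t ≡ h → Nf (replace-at t h)
  replace-at-neutral : ∀ {m} {t : Tm (m + n)} → Ne t → hypHead t ≡ nothing → Ne (replace-at t nothing)
  replace-normal nf = replace-at-normal nf refl
  replace-at-normal {h = just _}  nf          e = lams-ω-normal _
  replace-at-normal {h = nothing} (nf-ne ne)  e = nf-ne (replace-at-neutral ne e)
  replace-at-normal {h = nothing} (nf-lam nf) e = nf-lam (replace-normal nf)
  replace-at-neutral {m} (ne-var x) e with splitAt m x
  ... | inj₁ l = ne-var l
  replace-at-neutral (ne-app {t = s} ne nf) e =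
    ne-app (Eq.subst (λ h → Ne (replace-at s h)) (sym es) (replace-at-neutral ne es)) (replace-normal nf)
    where
    map-nothing : ∀ {A B : Set} {f : A → B} (x : Maybe A) → Maybe.map f x ≡ nothing → x ≡ nothing
    map-nothing nothing _ = refl
    es : hypHead s ≡ nothing
    es = map-nothing (hypHead s) e

  weaken : ∀ {m} → Tm m → Tm (m + n)
  weaken = renTm (_↑ˡ n)

  replace-dichotomy : ∀ {m} (t : Tm (m + n)) → ContainsΩ (replace t) ⊎ t ≡ weaken (replace t)
  replace-at-dichotomy : ∀ {m} (t : Tm (m + n)) h → hypHead t ≡ h → ContainsΩ (replace-at t h) ⊎ t ≡ weaken (replace-at t h)
  replace-dichotomy t = replace-at-dichotomy t (hypHead t) refl
  replace-at-dichotomy t (just _) e = inj₁ (lams-ω-contains _)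
  replace-at-dichotomy {m} (var x) nothing e with splitAt m x in es
  ... | inj₁ l = inj₂ (cong var (sym (splitAt⁻¹-↑ˡ es)))
  replace-at-dichotomy {m} (lam b) nothing e with replace-dichotomy b
  ... | inj₁ c  = inj₁ (inlam c)
  ... | inj₂ eq = inj₂ (cong lam (trans eq (renTm-cong ↑ˡ-extF (replace b))))
    where
    ↑ˡ-extF : ∀ i → (i ↑ˡ n) ≡ extF (_↑ˡ n) i
    ↑ˡ-extF zero    = refl
    ↑ˡ-extF (suc i) = refl
  replace-at-dichotomy (app s t) nothing e with replace-dichotomy s | replace-dichotomy t
  ... | inj₁ c  | _       = inj₁ (inl c)
  ... | inj₂ _  | inj₁ c  = inj₁ (inr c)
  ... | inj₂ e₁ | inj₂ e₂ = inj₂ (cong₂ app e₁ e₂)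

  Hypotheses : Ctx n → ℕ → Set
  Hypotheses Γd k = ∀ d → Σ (List Ty) λ cs → lookup Γd d ≡ cs ⇛ var k × length cs ≡ ar d × All WF cs

  hypotheses-shift : ∀ {Γd k} → Hypotheses Γd k → Hypotheses (map shift Γd) (suc k)
  hypotheses-shift {Γd} {k} hs d with hs d
  ... | cs , le , len , wf =
    List.map shift cs ,
    trans (lookup-map d shift Γd) (trans (cong shift le) (shift-⇛ cs (var k))) ,
    trans (length-map shift cs) len ,
    map⁺ (All.map (WF-rename suc) wf)

  replace-hypothesis-typing : ∀ {m} {Δ : Ctx m} {Γd : Ctx n} {k σ} → Hypotheses Γd k → WFσ σ → σ k ≡ D →
    ∀ {t T d j} → Δ ++ Γd ⊢[ F ] t ∶ T → hypHead t ≡ just (d , j) →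
    map (subst σ) Δ ⊢[ F ] lams-ω (ar d ∸ j) ∶ subst σ T
  replace-hypothesis-typing {m} {Δ} {Γd} {k} {σ} hs wσ eD {t} {d = d} der e with hypHead-spine t e
  ... | ps , refl , refl with hs d
  ... | cs , le , len , wfcs with spine der refl (trans (lookup-++ʳ Δ Γd d) le)
  ... | rest , args , refl =
    Eq.subst₂ (λ a B → map (subst σ) Δ ⊢[ F ] lams-ω a ∶ B) remaining-arity result-type
      (lams-ω-typing (List.map (subst σ) rest) (map⁺ (All.map (WF-subst wσ) (args-suffix args wfcs))))
    where
    remaining-arity : length (List.map (subst σ) rest) ≡ ar d ∸ length ps
    remaining-arity = begin
      length (List.map (subst σ) rest)    ≡⟨ length-map (subst σ) rest ⟩
      length rest                         ≡⟨ sym (m+n∸m≡n (length ps) (length rest)) ⟩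
      length ps + length rest ∸ length ps ≡⟨ cong (_∸ length ps) (sym (args-length args)) ⟩
      length cs ∸ length ps               ≡⟨ cong (_∸ length ps) len ⟩
      ar d ∸ length ps                    ∎
      where open Eq.≡-Reasoning
    result-type : List.map (subst σ) rest ⇛ D ≡ subst σ (rest ⇛ var k)
    result-type = trans (cong (List.map (subst σ) rest ⇛_) (sym eD)) (sym (subst-⇛ σ rest (var k)))

  replace-typing : ∀ {m} {Δ : Ctx m} {Γd : Ctx n} {k σ} → Hypotheses Γd k → WFσ σ → σ k ≡ D →
    ∀ {G t T h} → G ⊢[ F ] t ∶ T → G ≡ Δ ++ Γd → hypHead t ≡ h → map (subst σ) Δ ⊢[ F ] replace-at t h ∶ subst σ T
  replace-typing hs wσ eD {h = just _} der refl e = replace-hypothesis-typing hs wσ eD der e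
  replace-typing {m} {Δ} {Γd} {σ = σ} hs wσ eD {h = nothing} (ax x) refl e with splitAt m x in es
  ... | inj₁ l with splitAt⁻¹-↑ˡ es
  ... | refl = Eq.subst (λ T → map (subst σ) Δ ⊢[ F ] var l ∶ T)
                 (trans (lookup-map l (subst σ) Δ) (cong (subst σ) (sym (lookup-++ˡ Δ Γd l)))) (ax l)
  replace-typing hs wσ eD {h = nothing} (⇒i a der) refl e =
    ⇒i (WF-subst wσ a) (replace-typing hs wσ eD der refl refl)
  replace-typing hs wσ eD {h = nothing} (⇒e d₁ d₂) eG e =
    ⇒e (replace-typing hs wσ eD d₁ eG refl) (replace-typing hs wσ eD d₂ eG refl)
  replace-typing {Δ = Δ} {Γd} {σ = σ} hs wσ eD {t = t} {h = nothing} (∀i {A = A} a der) eG e =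
    ∀i (WF-subst wσ a)
      (Eq.subst (λ G → G ⊢[ F ] replace-at t nothing ∶ subst (exts σ) A) (sym (ctx-shift-subst σ Δ))
        (replace-typing {Δ = map shift Δ} (hypotheses-shift {Γd} hs) (WF-exts wσ) (cong shift eD)
          der (trans (cong (map shift) eG) (map-++ shift Δ Γd)) e))
  replace-typing {Δ = Δ} {σ = σ} hs wσ eD {t = t} {h = nothing} (∀e {A = A} {C} c der) eG e =
    Eq.subst (λ T → map (subst σ) Δ ⊢[ F ] replace-at t nothing ∶ T) (sym (subst-inst σ A C))
      (∀e (WF-subst wσ c) (replace-typing hs wσ eD der eG e))

  hypotheses-unused : ∀ {Γd : Ctx n} {k σ} → Hypotheses Γd k → WFσ σ → σ k ≡ D →
    ∀ {t T} → Nf t → Γd ⊢[ F ] t ∶ T →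
    (∀ (u : Tm 0) → Nf u → [] ⊢[ F ] u ∶ subst σ T → [] ⊢[ F₀ ] u ∶ subst σ T) →
    Σ (Tm 0) λ u → t ≡ weaken u × [] ⊢[ F₀ ] u ∶ subst σ T
  hypotheses-unused hs wσ eD {t} nf der toF₀
    with toF₀ (replace t) (replace-normal nf) (replace-typing {Δ = []} hs wσ eD der refl refl)
  ... | d₀ with replace-dichotomy {0} t
  ... | inj₁ c  = ⊥-elim (F₀-no-ω d₀ c)
  ... | inj₂ eq = replace t , eq , d₀

data ArgTy : Ty → Set where
  recursive : ArgTy (var 0)
  input     : ∀ {E} → InputType E → ArgTy (shift E)

HypTy : Ty → Set
HypTy H = Σ (List Ty) λ cs → All ArgTy cs × H ≡ cs ⇛ var 0

HypCtx : ∀ {n} → Ctx n → Set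
HypCtx Γ = ∀ x → HypTy (lookup Γ x)

_∷ʰ_ : ∀ {n} {H} {Γ : Ctx n} → HypTy H → HypCtx Γ → HypCtx (H ∷ Γ)
(h ∷ʰ hΓ) zero    = h
(h ∷ʰ hΓ) (suc x) = hΓ x

WF-arg : ∀ {c} → ArgTy c → WF c
WF-arg recursive          = wf-var
WF-arg (input (w , _ , _)) = WF-rename suc w

WF-hyp : ∀ {H} → HypTy H → WF H
WF-hyp (cs , acs , refl) = WF-⇛ (All.map WF-arg acs) wf-var

arg-closed : ∀ {c} → ArgTy c → ∀ n → ¬ Occurs (suc n) c
arg-closed recursive           n ()
arg-closed (input (_ , c , _)) n o = shift-closed c n o

hyp-closed : ∀ {H} → HypTy H → ∀ n → ¬ Occurs (suc n) H
hyp-closed (cs , acs , refl) n = not-occurs-⇛ (All.map (λ a → arg-closed a n) acs) (λ ())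

-- An argument of input type E in a context of hypotheses is F₀-typable:
-- instantiate X by D and apply the replacement argument.
input-argument : ∀ {n} {Γ : Ctx n} → HypCtx Γ → ∀ {E p} → InputType E →
  Nf p → Γ ⊢[ F ] p ∶ shift E → Γ ⊢[ F₀ ] p ∶ shift E
input-argument {n} {Γ} hΓ {E} (_ , cE , toF₀) nf d
  with hypotheses-unused hypotheses (WF-sub0 WF-D) refl nf d toF₀-E
  where
  open Replacement (λ x → length (proj₁ (hΓ x)))
  hypotheses : Hypotheses Γ 0
  hypotheses x with hΓ x
  ... | cs , acs , le = cs , le , refl , All.map WF-arg acs
  toF₀-E : ∀ u → Nf u → [] ⊢[ F ] u ∶ subst (sub0 D) (shift E) → [] ⊢[ F₀ ] u ∶ subst (sub0 D) (shift E)
  toF₀-E u nfu du = Eq.subst (λ T → [] ⊢[ F₀ ] u ∶ T) (sym (sub0-shift D E))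
                      (toF₀ u nfu (Eq.subst (λ T → [] ⊢[ F ] u ∶ T) (sub0-shift D E) du))
... | u , refl , d₀ =
  Eq.subst (λ T → Γ ⊢[ F₀ ] renTm (_↑ˡ n) u ∶ T) (trans (sub0-shift D E) (sym (closed-shift cE)))
    (typing-rename (_↑ˡ n) (λ ()) d₀)

-- Such a term is
-- λh.(…) or, by the spine lemma, a hypothesis applied to arguments of type X
-- (handled recursively) or of input type (handled by `input-argument`).

normal-F₀ : ∀ {n} {Γ : Ctx n} → HypCtx Γ → ∀ {t Hs} → All HypTy Hs → Nf t →
  Γ ⊢[ F ] t ∶ Hs ⇛ var 0 → Γ ⊢[ F₀ ] t ∶ Hs ⇛ var 0
lam-F₀ : ∀ {n} {Γ : Ctx n} → HypCtx Γ → ∀ {u Hs} → All HypTy Hs → Nf u →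
  LamTyping Γ u (Hs ⇛ var 0) → Γ ⊢[ F₀ ] lam u ∶ Hs ⇛ var 0
neutral-F₀ : ∀ {n} {Γ : Ctx n} → HypCtx Γ → ∀ {t T} → Ne t → Γ ⊢[ F ] t ∶ T → Γ ⊢[ F₀ ] t ∶ T
spine-F₀ : ∀ {n} {Γ : Ctx n} {x cs} → HypCtx Γ → lookup Γ x ≡ cs ⇛ var 0 → All ArgTy cs →
  ∀ {ps rest} → Ne (apps (var x) ps) → Args Γ cs ps rest → Γ ⊢[ F₀ ] apps (var x) ps ∶ rest ⇛ var 0
argument-F₀ : ∀ {n} {Γ : Ctx n} → HypCtx Γ → ∀ {p c} → ArgTy c → Nf p → Γ ⊢[ F ] p ∶ c → Γ ⊢[ F₀ ] p ∶ c

normal-F₀ hΓ hs (nf-lam nf) d = lam-F₀ hΓ hs nf (lam-generation d)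
normal-F₀ hΓ hs (nf-ne ne)  d = neutral-F₀ hΓ ne d

lam-F₀ hΓ (h ∷ hs) nf (arr d) = ⇒i (WF-hyp h) (normal-F₀ (h ∷ʰ hΓ) hs nf d)

neutral-F₀ hΓ ne d with neutral-spine ne
... | x , ps , refl with hΓ x
... | cs , acs , le with spine d refl le
... | rest , args , refl = spine-F₀ hΓ le acs ne args

spine-F₀ {Γ = Γ} {x} hΓ le acs ne nil = Eq.subst (λ T → Γ ⊢[ F₀ ] var x ∶ T) le (ax x)
spine-F₀ hΓ le acs (ne-app ne nf) (snoc args dp) with args-suffix args acs
... | ac ∷ _ = ⇒e (spine-F₀ hΓ le acs ne args) (argument-F₀ hΓ ac nf dp)

argument-F₀ hΓ recursive  nf d = normal-F₀ hΓ [] nf d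
argument-F₀ hΓ (input iE) nf d = input-argument hΓ iE nf d

spine-input-type : ∀ {Hs} → All HypTy Hs → InputType (∀' (Hs ⇛ var 0))
spine-input-type {Hs} hs = well-formed , closed , toF₀
  where
  well-formed : WF (∀' (Hs ⇛ var 0))
  well-formed = wf-∀ (occurs-target Hs here) (WF-⇛ (All.map WF-hyp hs) wf-var)
  closed : Closed (∀' (Hs ⇛ var 0))
  closed n (under o) = not-occurs-⇛ (All.map (λ h → hyp-closed h n) hs) (λ ()) o
  toF₀ : ∀ t → Nf t → [] ⊢[ F ] t ∶ ∀' (Hs ⇛ var 0) → [] ⊢[ F₀ ] t ∶ ∀' (Hs ⇛ var 0)
  toF₀ t (nf-ne ne) d = ⊥-elim (closed-not-neutral ne)
  toF₀ (lam u) (nf-lam nf) d with lam-generation d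
  ... | gen a l = ∀i a (lam-F₀ (λ ()) hs nf l)

-- A ∧ B = ∀X((A ⇒ B ⇒ X) ⇒ X),  A ∨ B = ∀X((A ⇒ X) ⇒ (B ⇒ X) ⇒ X)  and
-- L A = ∀X(X ⇒ (A ⇒ X ⇒ X) ⇒ X)  are all of this shape.
theorem2p2p9 : ∀ (A B : Ty) → InputType A → InputType B →
                 InputType (A ∧ B) × InputType (A ∨ B) × InputType (L A)
theorem2p2p9 A B iA iB =
  spine-input-type (hyp (input iA ∷ input iB ∷ []) ∷ []) ,
  spine-input-type (hyp (input iA ∷ []) ∷ hyp (input iB ∷ []) ∷ []) ,
  spine-input-type (hyp [] ∷ hyp (input iA ∷ recursive ∷ []) ∷ [])
  where
  hyp : ∀ {cs} → All ArgTy cs → HypTy (cs ⇛ var 0)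
  hyp acs = _ , acs , refl
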